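{- Let $n,p,k,s$ be positive integers with $p$ prime and $p>n\ge2$. Then $\binom{s+n-1}{n}$ is divisible by $p^k$ if and only if $s\equiv -t\pmod{p^k}$ for some $t\in[0,n-1]$.
   Context: $[0,n-1]=\{0,1,\ldots,n-1\}$. -}

module Defs where

-- Multiplying by n! turns the binomial coefficient into the rising product
-- s (s + 1) ⋯ (s + n − 1). As p > n, the factor n! is prime to p, and any two of the
-- n factors differ by less than p, so at most one of them is divisible by p: all
-- powers of p dividing the product divide that single factor.
module Submission where

open import Defs
open import Data.Nat using (ℕ; _+_; _∸_; _^_; _<_; _≤_)
open import Data.Nat.Divisibility using (_∣_)
open import Data.Nat.Primality using (Prime)
open import Data.Nat.Combinatorics using (_C_)
open import Data.Product using (∃-syntax; _×_)
open import Function.Bundles using (_⇔_)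

open import Data.Nat.Base using (zero; suc; _*_; _!; z≤n; s≤s; _≤ᵇ_; NonZero; nonTrivial⇒n>1)
open import Data.Nat.Properties
open import Data.Nat.Divisibility
open import Data.Nat.DivMod using (_/_; m/n*n≡m)
open import Data.Nat.Primality using (euclidsLemma; prime⇒nonZero; prime⇒nonTrivial)
open import Data.Nat.Combinatorics using (nCk≡nPk/k!)
open import Data.Nat.Combinatorics.Base using (_P_; _P′_)
open import Data.Nat.Combinatorics.Specification using (k!∣nP′k; nP′n≡n!)
open import Data.Product using (_,_)
open import Data.Sum using (inj₁; inj₂)
open import Data.Bool.Base using (true)
open import Data.Empty using (⊥-elim)
open import Relation.Nullary using (¬_; yes; no)
open import Relation.Binary.PropositionalEquality
open import Function.Bundles using (mk⇔)
open import Function.Properties.Equivalence using () renaming (sym to ⇔-sym; trans to ⇔-trans)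

risingFactorial : ℕ → ℕ → ℕ
risingFactorial s zero    = 1
risingFactorial s (suc j) = s * risingFactorial (suc s) j

[d+j]P′j≡risingFactorial[1+d]j : ∀ d j → (d + j) P′ j ≡ risingFactorial (suc d) j
[d+j]P′j≡risingFactorial[1+d]j d zero    = refl
[d+j]P′j≡risingFactorial[1+d]j d (suc j) = begin
  (d + suc j ∸ j) * ((d + suc j) P′ j)     ≡⟨ cong (λ x → (x ∸ j) * (x P′ j)) (+-suc d j) ⟩
  (suc d + j ∸ j) * ((suc d + j) P′ j)     ≡⟨ cong₂ _*_ (m+n∸n≡m (suc d) j) ([d+j]P′j≡risingFactorial[1+d]j (suc d) j) ⟩
  suc d * risingFactorial (suc (suc d)) j  ∎
  where open ≡-Reasoning

n!≡risingFactorial1n : ∀ n → n ! ≡ risingFactorial 1 n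
n!≡risingFactorial1n n = trans (sym (nP′n≡n! n)) ([d+j]P′j≡risingFactorial[1+d]j 0 n)

nCk*k!≡nP′k : ∀ {n k} → k ≤ n → (n C k) * k ! ≡ n P′ k
nCk*k!≡nP′k {n} {k} k≤n = begin
  (n C k) * k !                 ≡⟨ cong (_* k !) (nCk≡nPk/k! k≤n) ⟩
  ((n P k) / k !) * k !         ≡⟨ cong (λ x → (x / k !) * k !) nPk≡nP′k ⟩
  ((n P′ k) / k !) * k !        ≡⟨ m/n*n≡m (k!∣nP′k k≤n) ⟩
  n P′ k                        ∎
  where
  open ≡-Reasoning
  instance _ = k !≢0
  nPk≡nP′k : n P k ≡ n P′ k
  nPk≡nP′k with k ≤ᵇ n | ≤⇒≤ᵇ k≤n
  ... | true | _ = refl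

[m+n]Cn*n!≡risingFactorial[1+m]n : ∀ m n → ((m + n) C n) * n ! ≡ risingFactorial (suc m) n
[m+n]Cn*n!≡risingFactorial[1+m]n m n =
  trans (nCk*k!≡nP′k (m≤n+m n m)) ([d+j]P′j≡risingFactorial[1+d]j m n)

∣s+t⇒∣risingFactorial : ∀ {d} s {t j} → t < j → d ∣ s + t → d ∣ risingFactorial s j
∣s+t⇒∣risingFactorial {d} s {zero}  {suc j} _         d∣s+0   = ∣-trans (subst (d ∣_) (+-identityʳ s) d∣s+0) (m∣m*n _)
∣s+t⇒∣risingFactorial {d} s {suc t} {suc j} (s≤s t<j) d∣s+1+t =
  ∣-trans (∣s+t⇒∣risingFactorial (suc s) t<j (subst (d ∣_) (+-suc s t) d∣s+1+t)) (n∣m*n s)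

module _ {p : ℕ} (p-prime : Prime p) where

  private
    1<p : 1 < p
    1<p = nonTrivial⇒n>1 p {{prime⇒nonTrivial p-prime}}

    instance
      p≢0 : NonZero p
      p≢0 = prime⇒nonZero p-prime

  ¬p∣1+t : ∀ {t} → suc t < p → ¬ p ∣ suc t
  ¬p∣1+t 1+t<p p∣1+t = <⇒≱ 1+t<p (∣⇒≤ p∣1+t)

  ¬p∣* : ∀ {a b} → ¬ p ∣ a → ¬ p ∣ b → ¬ p ∣ a * b
  ¬p∣* {a} {b} p∤a p∤b p∣ab with euclidsLemma a b p-prime p∣ab
  ... | inj₁ p∣a = p∤a p∣a
  ... | inj₂ p∣b = p∤b p∣b

  p^k∣a*b∧¬p∣b⇒p^k∣a : ∀ k {a b} → p ^ k ∣ a * b → ¬ p ∣ b → p ^ k ∣ a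
  p^k∣a*b∧¬p∣b⇒p^k∣a zero    _     _   = 1∣ _
  p^k∣a*b∧¬p∣b⇒p^k∣a (suc k) {a} {b} p^[1+k]∣ab p∤b
    with euclidsLemma a b p-prime (∣-trans (m∣m*n (p ^ k)) p^[1+k]∣ab)
  ... | inj₂ p∣b              = ⊥-elim (p∤b p∣b)
  ... | inj₁ (divides q refl) = subst (p ^ suc k ∣_) (*-comm p q) (*-monoʳ-∣ p p^k∣q)
    where
    p^k∣qb : p ^ k ∣ q * b
    p^k∣qb = *-cancelˡ-∣ p (subst (p * p ^ k ∣_) (trans (cong (_* b) (*-comm q p)) (*-assoc p q b)) p^[1+k]∣ab)
    p^k∣q : p ^ k ∣ q
    p^k∣q = p^k∣a*b∧¬p∣b⇒p^k∣a k p^k∣qb p∤b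

  p^k∣a*b⇔p^k∣a : ∀ k {a b} → ¬ p ∣ b → p ^ k ∣ a * b ⇔ p ^ k ∣ a
  p^k∣a*b⇔p^k∣a k p∤b = mk⇔ (λ p^k∣ab → p^k∣a*b∧¬p∣b⇒p^k∣a k p^k∣ab p∤b) (λ p^k∣a → ∣-trans p^k∣a (m∣m*n _))

  ¬p∣risingFactorial : ∀ s j → (∀ {t} → t < j → ¬ p ∣ s + t) → ¬ p ∣ risingFactorial s j
  ¬p∣risingFactorial s zero    _     = ¬p∣1+t 1<p
  ¬p∣risingFactorial s (suc j) p∤s+t = ¬p∣* (subst (λ x → ¬ p ∣ x) (+-identityʳ s) (p∤s+t (s≤s z≤n)))
    (¬p∣risingFactorial (suc s) j (λ t<j → subst (λ x → ¬ p ∣ x) (+-suc s _) (p∤s+t (s≤s t<j))))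

  ¬p∣n! : ∀ {n} → n < p → ¬ p ∣ n !
  ¬p∣n! {n} n<p = subst (λ x → ¬ p ∣ x) (sym (n!≡risingFactorial1n n))
    (¬p∣risingFactorial 1 n (λ t<n → ¬p∣1+t (<-≤-trans (s≤s t<n) n<p)))

  -- Once p ∣ s, the later factors s + 1 + t are not divisible by p, because 0 < 1 + t < p.
  p^k∣risingFactorial⇒p^k∣s+t : ∀ k s j → 1 ≤ k → j ≤ p → p ^ k ∣ risingFactorial s j → ∃[ t ] (t < j × p ^ k ∣ s + t)
  p^k∣risingFactorial⇒p^k∣s+t (suc k) s zero _ _ p^[1+k]∣1 = ⊥-elim (¬p∣1+t 1<p (∣-trans (m∣m*n (p ^ k)) p^[1+k]∣1))
  p^k∣risingFactorial⇒p^k∣s+t k s (suc j) 1≤k 1+j≤p p^k∣prod with p ∣? s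
  ... | yes p∣s = 0 , s≤s z≤n , subst (p ^ k ∣_) (sym (+-identityʳ s)) (p^k∣a*b∧¬p∣b⇒p^k∣a k p^k∣prod p∤rest)
    where
    p∤rest : ¬ p ∣ risingFactorial (suc s) j
    p∤rest = ¬p∣risingFactorial (suc s) j λ {t} t<j p∣1+s+t →
      ¬p∣1+t (<-≤-trans (s≤s t<j) 1+j≤p) (∣m+n∣m⇒∣n (subst (p ∣_) (sym (+-suc s t)) p∣1+s+t) p∣s)
  ... | no p∤s with p^k∣risingFactorial⇒p^k∣s+t k (suc s) j 1≤k (≤-trans (n≤1+n j) 1+j≤p)
                      (p^k∣a*b∧¬p∣b⇒p^k∣a k (subst (p ^ k ∣_) (*-comm s _) p^k∣prod) p∤s)
  ...   | t , t<j , p^k∣1+s+t = suc t , s≤s t<j , subst (p ^ k ∣_) (sym (+-suc s t)) p^k∣1+s+t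

  p^k∣risingFactorial⇔p^k∣s+t : ∀ k s j → 1 ≤ k → j ≤ p → p ^ k ∣ risingFactorial s j ⇔ (∃[ t ] (t < j × p ^ k ∣ s + t))
  p^k∣risingFactorial⇔p^k∣s+t k s j 1≤k j≤p = mk⇔ (p^k∣risingFactorial⇒p^k∣s+t k s j 1≤k j≤p)
    (λ (t , t<j , p^k∣s+t) → ∣s+t⇒∣risingFactorial s t<j p^k∣s+t)

proposition2p3 : (n p k s : ℕ) → 1 ≤ k → 1 ≤ s → Prime p → 2 ≤ n → n < p →
    ((p ^ k) ∣ ((s + n ∸ 1) C n)) ⇔ (∃[ t ] (t < n × (p ^ k) ∣ (s + t)))
proposition2p3 n p k (suc m) 1≤k _ p-prime _ n<p =
  ⇔-trans (⇔-sym (p^k∣a*b⇔p^k∣a p-prime k (¬p∣n! p-prime n<p)))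
    (subst (λ x → p ^ k ∣ x ⇔ (∃[ t ] (t < n × p ^ k ∣ suc m + t)))
      (sym ([m+n]Cn*n!≡risingFactorial[1+m]n m n))
      (p^k∣risingFactorial⇔p^k∣s+t p-prime k (suc m) n 1≤k (<⇒≤ n<p)))
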